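{- For any positive integer $k$, put $r(k)=324k^4 +648k^3 +516k^2 +192k +26$. Then for every integer $k \geq 1$, \begin{equation*} \frac{1}{r(k)+0.9}-\frac{1}{r(k+1)+0.9}< \frac{1}{(3k+2)^5}+\frac{1}{(3k+3)^5}+\frac{1}{(3k+4)^5}<\frac{1}{r(k)}-\frac{1}{r(k+1)}. \end{equation*} -}

module Defs where

open import Data.Nat using (ℕ; suc; _+_; _*_; _^_; NonZero)
open import Data.Nat.Properties using (+-suc; m^n≢0)
open import Data.Integer using (+_)
open import Data.Rational using (ℚ; _/_)

r : ℕ → ℕ
r k = 324 * k ^ 4 + 648 * k ^ 3 + 516 * k ^ 2 + 192 * k + 26

private
  pos+ : ∀ m c → NonZero (m + suc c)
  pos+ m c rewrite +-suc m c = _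

  -- r k = r0 k + 26 = r0 k + suc 25
  r0 : ℕ → ℕ
  r0 k = 324 * k ^ 4 + 648 * k ^ 3 + 516 * k ^ 2 + 192 * k

invR : ℕ → ℚ
invR k = + 1 / r k
  where instance _ = pos+ (r0 k) 25

-- 1 / (r(k) + 0.9), written exactly as 10 / (10 r(k) + 9)
invR09 : ℕ → ℚ
invR09 k = + 10 / (10 * r k + 9)
  where instance _ = pos+ (10 * r k) 8

-- 1 / n^5 for n ≥ 1, given as 1 / (suc m)^5
invPow5 : ℕ → ℚ
invPow5 m = + 1 / (suc m ^ 5)
  where instance _ = m^n≢0 (suc m) 5

-- Writing S for the sum of the three reciprocal fifth powers, each inequality becomes, after
-- moving the subtracted fraction to the other side and clearing denominators, an inequality
-- between two polynomials in k with natural coefficients. After the substitution k = j + 1 the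
-- larger polynomial dominates the smaller one coefficientwise in j, with a strictly larger
-- constant term, and this comparison is carried out by computing normal forms.

module Submission where

open import Defs
open import Data.Nat using (ℕ; suc; _+_; _*_; _≥_)
open import Data.Product using (_×_)

module NatPolynomial where
  open import Data.Bool using (Bool; true; false; T; _∧_)
  open import Data.Bool.Properties using (T-∧)
  open import Data.List using (List; []; _∷_; map)
  open import Data.Nat using (ℕ; zero; suc; _+_; _*_; _^_; _≤_; _<_; _≤ᵇ_; _<ᵇ_; z≤n)
  open import Data.Nat.Properties
    using (≤ᵇ⇒≤; <ᵇ⇒<; +-mono-≤; +-mono-<-≤; *-monoʳ-≤; +-identityʳ; *-identityʳ; *-zeroʳ; *-assoc;
           *-distribˡ-+; *-distribʳ-+; +-commutativeSemigroup; *-commutativeSemigroup)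
  open import Algebra.Properties.CommutativeSemigroup +-commutativeSemigroup using (interchange)
  open import Algebra.Properties.CommutativeSemigroup *-commutativeSemigroup using (x∙yz≈y∙xz)
  open import Data.Product using (_,_)
  open import Function.Bundles using (module Equivalence)
  open import Relation.Binary.PropositionalEquality
    using (_≡_; refl; sym; trans; cong; cong₂; subst₂; module ≡-Reasoning)
  open ≡-Reasoning

  -- Coefficient lists, constant term first.
  Poly : Set
  Poly = List ℕ

  eval : Poly → ℕ → ℕ
  eval []      x = 0
  eval (a ∷ p) x = a + x * eval p x

  infixl 6 _+ᴾ_
  infixl 7 _*ᴾ_ _·ᴾ_
  infixr 8 _^ᴾ_

  _+ᴾ_ : Poly → Poly → Poly
  []      +ᴾ q       = q
  (a ∷ p) +ᴾ []      = a ∷ p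
  (a ∷ p) +ᴾ (b ∷ q) = (a + b) ∷ (p +ᴾ q)

  _·ᴾ_ : ℕ → Poly → Poly
  a ·ᴾ p = map (a *_) p

  _*ᴾ_ : Poly → Poly → Poly
  []      *ᴾ q = []
  (a ∷ p) *ᴾ q = a ·ᴾ q +ᴾ (0 ∷ p *ᴾ q)

  _^ᴾ_ : Poly → ℕ → Poly
  p ^ᴾ zero  = 1 ∷ []
  p ^ᴾ suc n = p *ᴾ p ^ᴾ n

  eval-+ᴾ : ∀ p q x → eval (p +ᴾ q) x ≡ eval p x + eval q x
  eval-+ᴾ []      q       x = refl
  eval-+ᴾ (a ∷ p) []      x = sym (+-identityʳ _)
  eval-+ᴾ (a ∷ p) (b ∷ q) x = begin
    a + b + x * eval (p +ᴾ q) x          ≡⟨ cong (λ e → a + b + x * e) (eval-+ᴾ p q x) ⟩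
    a + b + x * (eval p x + eval q x)    ≡⟨ cong (a + b +_) (*-distribˡ-+ x (eval p x) (eval q x)) ⟩
    a + b + (x * eval p x + x * eval q x) ≡⟨ interchange a b _ _ ⟩
    a + x * eval p x + (b + x * eval q x) ∎

  eval-·ᴾ : ∀ a p x → eval (a ·ᴾ p) x ≡ a * eval p x
  eval-·ᴾ a []      x = sym (*-zeroʳ a)
  eval-·ᴾ a (b ∷ p) x = begin
    a * b + x * eval (a ·ᴾ p) x ≡⟨ cong (λ e → a * b + x * e) (eval-·ᴾ a p x) ⟩
    a * b + x * (a * eval p x)  ≡⟨ cong (a * b +_) (x∙yz≈y∙xz x a (eval p x)) ⟩
    a * b + a * (x * eval p x)  ≡⟨ *-distribˡ-+ a b (x * eval p x) ⟨
    a * (b + x * eval p x)      ∎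

  eval-*ᴾ : ∀ p q x → eval (p *ᴾ q) x ≡ eval p x * eval q x
  eval-*ᴾ []      q x = refl
  eval-*ᴾ (a ∷ p) q x = begin
    eval (a ·ᴾ q +ᴾ (0 ∷ p *ᴾ q)) x          ≡⟨ eval-+ᴾ (a ·ᴾ q) (0 ∷ p *ᴾ q) x ⟩
    eval (a ·ᴾ q) x + x * eval (p *ᴾ q) x    ≡⟨ cong₂ (λ u v → u + x * v) (eval-·ᴾ a q x) (eval-*ᴾ p q x) ⟩
    a * eval q x + x * (eval p x * eval q x) ≡⟨ cong (a * eval q x +_) (*-assoc x (eval p x) (eval q x)) ⟨
    a * eval q x + x * eval p x * eval q x   ≡⟨ *-distribʳ-+ (eval q x) a (x * eval p x) ⟨
    (a + x * eval p x) * eval q x            ∎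

  eval-^ᴾ : ∀ p n x → eval (p ^ᴾ n) x ≡ eval p x ^ n
  eval-^ᴾ p zero    x = cong suc (*-zeroʳ x)
  eval-^ᴾ p (suc n) x = trans (eval-*ᴾ p (p ^ᴾ n) x) (cong (eval p x *_) (eval-^ᴾ p n x))

  infixl 6 _⊕_
  infixl 7 _⊗_
  infixr 8 _⊛_

  data Term : Set where
    var : Term
    con : ℕ → Term
    _⊕_ _⊗_ : Term → Term → Term
    _⊛_ : Term → ℕ → Term

  ⟦_⟧ : Term → ℕ → ℕ
  ⟦ var   ⟧ x = x
  ⟦ con n ⟧ x = n
  ⟦ s ⊕ t ⟧ x = ⟦ s ⟧ x + ⟦ t ⟧ x
  ⟦ s ⊗ t ⟧ x = ⟦ s ⟧ x * ⟦ t ⟧ x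
  ⟦ t ⊛ n ⟧ x = ⟦ t ⟧ x ^ n

  normalise : Term → Poly
  normalise var     = 0 ∷ 1 ∷ []
  normalise (con n) = n ∷ []
  normalise (s ⊕ t) = normalise s +ᴾ normalise t
  normalise (s ⊗ t) = normalise s *ᴾ normalise t
  normalise (t ⊛ n) = normalise t ^ᴾ n

  eval-normalise : ∀ t x → eval (normalise t) x ≡ ⟦ t ⟧ x
  eval-normalise var     x = trans (cong (λ e → x * suc e) (*-zeroʳ x)) (*-identityʳ x)
  eval-normalise (con n) x = trans (cong (n +_) (*-zeroʳ x)) (+-identityʳ n)
  eval-normalise (s ⊕ t) x =
    trans (eval-+ᴾ (normalise s) (normalise t) x) (cong₂ _+_ (eval-normalise s x) (eval-normalise t x))
  eval-normalise (s ⊗ t) x =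
    trans (eval-*ᴾ (normalise s) (normalise t) x) (cong₂ _*_ (eval-normalise s x) (eval-normalise t x))
  eval-normalise (t ⊛ n) x = trans (eval-^ᴾ (normalise t) n x) (cong (_^ n) (eval-normalise t x))

  _≤ᶜ_ : Poly → Poly → Bool
  []      ≤ᶜ q       = true
  (a ∷ p) ≤ᶜ []      = false
  (a ∷ p) ≤ᶜ (b ∷ q) = (a ≤ᵇ b) ∧ (p ≤ᶜ q)

  _<ᶜ_ : Poly → Poly → Bool
  (a ∷ p) <ᶜ (b ∷ q) = (a <ᵇ b) ∧ (p ≤ᶜ q)
  _       <ᶜ _       = false

  ≤ᶜ⇒eval-≤ : ∀ p q x → T (p ≤ᶜ q) → eval p x ≤ eval q x
  ≤ᶜ⇒eval-≤ []      q       x _ = z≤n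
  ≤ᶜ⇒eval-≤ (a ∷ p) (b ∷ q) x t with a≤b , p≤q ← Equivalence.to (T-∧ {a ≤ᵇ b}) t =
    +-mono-≤ (≤ᵇ⇒≤ a b a≤b) (*-monoʳ-≤ x (≤ᶜ⇒eval-≤ p q x p≤q))

  <ᶜ⇒eval-< : ∀ p q x → T (p <ᶜ q) → eval p x < eval q x
  <ᶜ⇒eval-< (a ∷ p) (b ∷ q) x t with a<b , p≤q ← Equivalence.to (T-∧ {a <ᵇ b}) t =
    +-mono-<-≤ (<ᵇ⇒< a b a<b) (*-monoʳ-≤ x (≤ᶜ⇒eval-≤ p q x p≤q))

  <-by-coefficients : ∀ s t → T (normalise s <ᶜ normalise t) → ∀ x → ⟦ s ⟧ x < ⟦ t ⟧ x
  <-by-coefficients s t s<t x =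
    subst₂ _<_ (eval-normalise s x) (eval-normalise t x) (<ᶜ⇒eval-< (normalise s) (normalise t) x s<t)

open NatPolynomial using (Term; var; con; _⊕_; _⊗_; _⊛_; ⟦_⟧; <-by-coefficients)

open import Data.Nat as ℕ using (NonZero; s≤s; z≤n)
open import Data.Nat.Properties using (≤-trans; m≤n+m)
open import Data.Nat.Tactic.RingSolver using (solve-∀)
open import Data.Product using (_,_)
open import Data.Integer using (+_; +<+)
open import Data.Rational using (_<_; _/_; toℚᵘ; -_) renaming (_+_ to _+ℚ_; _-_ to _-ℚ_)
open import Data.Rational.Properties
  using (toℚᵘ-cancel-<; toℚᵘ-homo-+; toℚᵘ-fromℚᵘ; +-monoˡ-<; +-0-group)
open import Data.Rational.Unnormalised as ℚᵘ using (mkℚᵘ; _≃_; *<*)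
import Data.Rational.Unnormalised.Properties as ℚᵘ
open import Algebra.Properties.Group +-0-group using (//-rightDividesʳ)
open import Relation.Binary.PropositionalEquality using (_≡_; cong; subst)
open import Data.Unit using (tt)

p+q<r⇒p<r-q : ∀ p q r → p +ℚ q < r → p < r -ℚ q
p+q<r⇒p<r-q p q r p+q<r = subst (_< r -ℚ q) (//-rightDividesʳ q p) (+-monoˡ-< (- q) p+q<r)

r<p+q⇒r-q<p : ∀ p q r → r < p +ℚ q → r -ℚ q < p
r<p+q⇒r-q<p p q r r<p+q = subst (r -ℚ q <_) (//-rightDividesʳ q p) (+-monoˡ-< (- q) r<p+q)

<-via-toℚᵘ : ∀ {p q p′ q′} → toℚᵘ p ≃ p′ → toℚᵘ q ≃ q′ → p′ ℚᵘ.< q′ → p < q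
<-via-toℚᵘ p≃ q≃ p′<q′ =
  toℚᵘ-cancel-< (ℚᵘ.<-respˡ-≃ (ℚᵘ.≃-sym p≃) (ℚᵘ.<-respʳ-≃ (ℚᵘ.≃-sym q≃) p′<q′))

toℚᵘ-/ : ∀ a m → toℚᵘ (+ a / suc m) ≃ mkℚᵘ (+ a) m
toℚᵘ-/ a m = toℚᵘ-fromℚᵘ (mkℚᵘ (+ a) m)

toℚᵘ-+ : ∀ {p q p′ q′} → toℚᵘ p ≃ p′ → toℚᵘ q ≃ q′ → toℚᵘ (p +ℚ q) ≃ p′ ℚᵘ.+ q′
toℚᵘ-+ {p} {q} p≃ q≃ = ℚᵘ.≃-trans (toℚᵘ-homo-+ p q) (ℚᵘ.+-cong p≃ q≃)

toℚᵘ-reciprocals-+-/ : ∀ a x y z w →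
  toℚᵘ (+ 1 / suc x +ℚ + 1 / suc y +ℚ + 1 / suc z +ℚ + a / suc w)
    ≃ mkℚᵘ (+ 1) x ℚᵘ.+ mkℚᵘ (+ 1) y ℚᵘ.+ mkℚᵘ (+ 1) z ℚᵘ.+ mkℚᵘ (+ a) w
toℚᵘ-reciprocals-+-/ a x y z w =
  toℚᵘ-+ (toℚᵘ-+ (toℚᵘ-+ (toℚᵘ-/ 1 x) (toℚᵘ-/ 1 y)) (toℚᵘ-/ 1 z)) (toℚᵘ-/ a w)

-- 1/X + 1/Y + 1/Z + a/W = numerator a X Y Z W / (X Y Z W)
numerator : ℕ → ℕ → ℕ → ℕ → ℕ → ℕ
numerator a X Y Z W = (X * Y + X * Z + Y * Z) * W + a * (X * Y * Z)

-- The right-hand side is the numerator that ℚᵘ's _+_ produces by definitional unfolding.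
numerator-unfolded : ∀ a X Y Z W →
  (X * Y + X * Z + Y * Z) * W + a * (X * Y * Z) ≡ ((1 * Y + 1 * X) * Z + 1 * (X * Y)) * W + a * (X * Y * Z)
numerator-unfolded = solve-∀

reciprocals-+-/-<-/ : ∀ a X Y Z V W .{{_ : NonZero a}} .{{_ : NonZero X}} .{{_ : NonZero Y}} .{{_ : NonZero Z}}
  .{{_ : NonZero V}} .{{_ : NonZero W}} → numerator a X Y Z W * V ℕ.< a * (X * Y * Z * W) →
  + 1 / X +ℚ + 1 / Y +ℚ + 1 / Z +ℚ + a / W < + a / V
reciprocals-+-/-<-/ a@(suc _) X@(suc x) Y@(suc y) Z@(suc z) V@(suc v) W@(suc w) N<D =
  <-via-toℚᵘ (toℚᵘ-reciprocals-+-/ a x y z w) (toℚᵘ-/ a v)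
    (*<* (+<+ (subst (ℕ._< a * (X * Y * Z * W)) (cong (_* V) (numerator-unfolded a X Y Z W)) N<D)))

/-<-reciprocals-+-/ : ∀ a X Y Z V W .{{_ : NonZero a}} .{{_ : NonZero X}} .{{_ : NonZero Y}} .{{_ : NonZero Z}}
  .{{_ : NonZero V}} .{{_ : NonZero W}} → a * (X * Y * Z * W) ℕ.< numerator a X Y Z W * V →
  + a / V < + 1 / X +ℚ + 1 / Y +ℚ + 1 / Z +ℚ + a / W
/-<-reciprocals-+-/ a@(suc _) X@(suc x) Y@(suc y) Z@(suc z) V@(suc v) W@(suc w) D<N =
  <-via-toℚᵘ (toℚᵘ-/ a v) (toℚᵘ-reciprocals-+-/ a x y z w)
    (*<* (+<+ (subst (a * (X * Y * Z * W) ℕ.<_) (cong (_* V) (numerator-unfolded a X Y Z W)) D<N)))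

-- 10 (r k + 0.9)
r₉ : ℕ → ℕ
r₉ k = 10 * r k + 9

instance
  r-nonZero : ∀ {k} → NonZero (r k)
  r-nonZero = ℕ.>-nonZero (≤-trans (s≤s z≤n) (m≤n+m 26 _))

  r₉-nonZero : ∀ {k} → NonZero (r₉ k)
  r₉-nonZero = ℕ.>-nonZero (≤-trans (s≤s z≤n) (m≤n+m 9 _))

rᵗ r₉ᵗ : Term → Term
rᵗ t  = con 324 ⊗ t ⊛ 4 ⊕ con 648 ⊗ t ⊛ 3 ⊕ con 516 ⊗ t ⊛ 2 ⊕ con 192 ⊗ t ⊕ con 26
r₉ᵗ t = con 10 ⊗ rᵗ t ⊕ con 9

numeratorᵗ : Term → Term → Term → Term → Term → Term
numeratorᵗ a X Y Z W = (X ⊗ Y ⊕ X ⊗ Z ⊕ Y ⊗ Z) ⊗ W ⊕ a ⊗ (X ⊗ Y ⊗ Z)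

-- Each Term below evaluates at j definitionally to the natural number of the same name; the
-- inequalities hold coefficientwise only in j, not in k.
module ClearedInequalities (j : ℕ) where
  k : ℕ
  k = suc j

  X Y Z : ℕ
  X = suc (3 * k + 1) ℕ.^ 5
  Y = suc (3 * k + 2) ℕ.^ 5
  Z = suc (3 * k + 3) ℕ.^ 5

  kᵗ Xᵗ Yᵗ Zᵗ : Term
  kᵗ = con 1 ⊕ var
  Xᵗ = (con 1 ⊕ (con 3 ⊗ kᵗ ⊕ con 1)) ⊛ 5
  Yᵗ = (con 1 ⊕ (con 3 ⊗ kᵗ ⊕ con 2)) ⊛ 5
  Zᵗ = (con 1 ⊕ (con 3 ⊗ kᵗ ⊕ con 3)) ⊛ 5

  upper : numerator 1 X Y Z (r (suc k)) * r k ℕ.< 1 * (X * Y * Z * r (suc k))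
  upper = <-by-coefficients
    (numeratorᵗ (con 1) Xᵗ Yᵗ Zᵗ (rᵗ (con 1 ⊕ kᵗ)) ⊗ rᵗ kᵗ)
    (con 1 ⊗ (Xᵗ ⊗ Yᵗ ⊗ Zᵗ ⊗ rᵗ (con 1 ⊕ kᵗ))) tt j

  lower : 10 * (X * Y * Z * r₉ (suc k)) ℕ.< numerator 10 X Y Z (r₉ (suc k)) * r₉ k
  lower = <-by-coefficients
    (con 10 ⊗ (Xᵗ ⊗ Yᵗ ⊗ Zᵗ ⊗ r₉ᵗ (con 1 ⊕ kᵗ)))
    (numeratorᵗ (con 10) Xᵗ Yᵗ Zᵗ (r₉ᵗ (con 1 ⊕ kᵗ)) ⊗ r₉ᵗ kᵗ) tt j

lemma3p3 : (k : ℕ) → k ≥ 1 →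
    ((invR09 k -ℚ invR09 (suc k)) < ((invPow5 (3 * k + 1) +ℚ invPow5 (3 * k + 2)) +ℚ invPow5 (3 * k + 3)))
    × (((invPow5 (3 * k + 1) +ℚ invPow5 (3 * k + 2)) +ℚ invPow5 (3 * k + 3)) < (invR k -ℚ invR (suc k)))
lemma3p3 (suc j) _ =
    r<p+q⇒r-q<p _ _ _ (/-<-reciprocals-+-/ 10 X Y Z (r₉ k) (r₉ (suc k)) lower)
  , p+q<r⇒p<r-q _ _ _ (reciprocals-+-/-<-/ 1 X Y Z (r k) (r (suc k)) upper)
  where open ClearedInequalities j
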